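{- Let $G=(V,E)$ be a finite, undirected, unweighted, connected graph without self-loops, and let $k$ be a positive integer. Let $D\subseteq V$ be a set of vertices such that $|V\setminus D|\ge k$ and every $v\in D$ is dominated by some $u\in V\setminus D$ (i.e. $N[v]\subseteq N[u]$). Let $A\subseteq D$ be a set of vertices together with a map $\rho:A\to V\setminus A$ such that for every $v\in A$, with $u=\rho(v)$: $u$ is a cut vertex of $G$, $v$ lies in a connected component $C$ of $G-u$ with $C\subseteq D$, and every vertex of $C$ is dominated by $u$. For $u\in V\setminus A$ let $\alpha(u)=|\{v\in A:\rho(v)=u\}|$. Let $\widetilde d:V\setminus A\to\mathbb{Z}_{\ge 2}$ be arbitrary. Consider the following reduced ILP with binary variables $x_{v,i}\in\{0,1\}$ for $v\in V\setminus A$ and $i\in\{0,\dots,\widetilde d(v)\}$, where $x_{v,0}$ is fixed to $0$ for $v\in D\setminus A$: minimize $\sum_{v\in V\setminus A}\sum_{i=0}^{\widetilde d(v)} x_{v,i}\,(\alpha(v)(i+1)+i)$ subject to (i) $\sum_{v\in V\setminus D} x_{v,0}=k$; (ii) $\sum_{i=0}^{\widetilde d(v)} x_{v,i}=1$ for all $v\in V\setminus A$; (iii) $x_{v,i}\le \sum_{w\in V\setminus D:\ \mathrm{dist}(v,w)=i} x_{w,0}$ for all $v\in V\setminus A$ and all $i\in\{0,\dots,\widetilde d(v)-1\}$ (no such constraint is imposed for $i=\widetilde d(v)$, so $x_{v,\widetilde d(v)}=1$ means "distance at least $\widetilde d(v)$"). Suppose an optimal solution of this ILP is sufficient, i.e.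 for every $v\in V\setminus A$, either $x_{v,\widetilde d(v)}=0$ or $\widetilde d(v)\ge \mathrm{ecc}(v)$. Then $S^*=\{v\in V\setminus D: x_{v,0}=1\}$ is a globally optimal solution of group closeness centrality maximization, i.e. $|S^*|=k$ and $f(S^*)=\min\{f(S): S\subseteq V,\ |S|=k\}$.
   Context: $N[v]=N(v)\cup\{v\}$ is the closed neighborhood; a vertex $u$ dominates $v$ if $N[v]\subseteq N[u]$. $\mathrm{dist}(u,v)$ is shortest-path distance, $\mathrm{dist}(u,S)=\min_{s\in S}\mathrm{dist}(u,s)$, $\mathrm{ecc}(v)=\max_{u\in V}\mathrm{dist}(u,v)$. A cut vertex $w$ is one such that $G-w$ has more connected components than $G$. The group farness is $f(S)=\sum_{u\in V}\mathrm{dist}(u,S)$ and group closeness centrality is $c(S)=(|V|-|S|)/f(S)$; maximizing $c$ over sets of size $k$ is equivalent to minimizing $f$ over sets of size $k$. -}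

module Defs where

import Data.Nat
open import Data.Nat using (ℕ; zero; suc; _+_; _*_; _≤_; _<_; _⊔_; _⊓_)
open import Data.Bool using (Bool; true; false; _∧_; _∨_; if_then_else_; not)
open import Data.Fin using (Fin; _≟_)
open import Data.Fin.Subset using (Subset; _∈_; _∉_)
import Data.Vec
open import Data.Vec using (lookup)
import Data.List.Base as L
open import Data.Nat.ListAction using () renaming (sum to sumL)
open import Data.Bool.ListAction using () renaming (any to anyL)
open import Data.Product using (Σ; _×_; _,_; ∃)
open import Data.Sum using (_⊎_)
open import Data.Unit using (⊤)
open import Relation.Nullary using (¬_)
open import Relation.Nullary.Decidable using (⌊_⌋)
open import Relation.Binary.PropositionalEquality using (_≡_; _≢_)

record Graph (n : ℕ) : Set where
  field
    adj        : Fin n → Fin n → Bool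
    adj-sym    : ∀ u v → adj u v ≡ adj v u
    adj-irrefl : ∀ v → adj v v ≡ false
open Graph public

module _ {n : ℕ} where

  sumV : (Fin n → ℕ) → ℕ
  sumV f = sumL (L.map f (L.allFin n))

  maxV : (Fin n → ℕ) → ℕ
  maxV f = L.foldr _⊔_ 0 (L.map f (L.allFin n))

  anyV : (Fin n → Bool) → Bool
  anyV p = anyL p (L.allFin n)

  sumUpTo : ℕ → (ℕ → ℕ) → ℕ
  sumUpTo d f = sumL (L.map f (L.upTo (suc d)))

  [_] : Bool → ℕ
  [ b ] = if b then 1 else 0

  _∈ᵇ_ : Fin n → Subset n → Bool
  v ∈ᵇ S = lookup S v

  data Reach (G : Graph n) (P : Fin n → Set) : Fin n → Fin n → Set where
    here : ∀ {u} → P u → Reach G P u u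
    step : ∀ {u w v} → P u → adj G u w ≡ true → Reach G P w v → Reach G P u v

  Connected : Graph n → Set
  Connected G = ∀ u v → Reach G (λ _ → ⊤) u v

  within : Graph n → ℕ → Fin n → Fin n → Bool
  within G zero    u v = ⌊ u ≟ v ⌋
  within G (suc i) u v = within G i u v ∨ anyV (λ w → adj G u w ∧ within G i w v)

  distSearch : Graph n → ℕ → ℕ → Fin n → Fin n → ℕ
  distSearch G zero    i u v = i
  distSearch G (suc f) i u v = if within G i u v then i else distSearch G f (suc i) u v

  -- shortest-path distance (for connected G this is always < n)
  dist : Graph n → Fin n → Fin n → ℕ
  dist G u v = distSearch G n 0 u v

  ecc : Graph n → Fin n → ℕ
  ecc G v = maxV (λ u → dist G u v)

  -- dist(u,S) = min_{s ∈ S} dist(u,s); the start value n is never attained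
  -- for nonempty S in a connected graph, since all distances are < n.
  distSet : Graph n → Fin n → Subset n → ℕ
  distSet G u S = L.foldr _⊓_ n
    (L.map (λ s → if s ∈ᵇ S then dist G u s else n) (L.allFin n))

  farness : Graph n → Subset n → ℕ
  farness G S = sumV (λ u → distSet G u S)

  ClosedNbr : Graph n → Fin n → Fin n → Set
  ClosedNbr G v w = (w ≡ v) ⊎ (adj G v w ≡ true)

  Dominates : Graph n → Fin n → Fin n → Set
  Dominates G u v = ∀ w → ClosedNbr G v w → ClosedNbr G u w

  -- For a connected graph G, "G - w has more connected components than G"
  -- means G - w has at least two components: two vertices other than w
  -- not joined by any walk avoiding w.
  IsCutVertex : Graph n → Fin n → Set
  IsCutVertex G w =
    Σ (Fin n) λ a → Σ (Fin n) λ b →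
      (a ≢ w) × (b ≢ w) × ¬ Reach G (λ x → x ≢ w) a b

  alpha : Subset n → (Fin n → Fin n) → Fin n → ℕ
  alpha A ρ u = sumV (λ v → [ (v ∈ᵇ A) ∧ ⌊ ρ v ≟ u ⌋ ])

  -- The reduced ILP.  An assignment x : Fin n → ℕ → Bool gives x_{v,i};
  -- only values with v ∉ A and i ≤ d̃ v are used.
  objective : Subset n → (Fin n → Fin n) → (Fin n → ℕ) → (Fin n → ℕ → Bool) → ℕ
  objective A ρ d̃ x =
    sumV (λ v → if v ∈ᵇ A then 0 else
      sumUpTo (d̃ v) (λ i → [ x v i ] * (alpha A ρ v * (i + 1) + i)))

  record Feasible (G : Graph n) (k : ℕ) (D A : Subset n) (d̃ : Fin n → ℕ)
                  (x : Fin n → ℕ → Bool) : Set where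
    field
      fixed0 : ∀ v → v ∈ D → v ∉ A → x v 0 ≡ false
      con-i  : sumV (λ v → if v ∈ᵇ D then 0 else [ x v 0 ]) ≡ k
      con-ii : ∀ v → v ∉ A → sumUpTo (d̃ v) (λ i → [ x v i ]) ≡ 1
      con-iii : ∀ v → v ∉ A → ∀ i → i < d̃ v →
        [ x v i ] ≤ sumV (λ w → if w ∈ᵇ D then 0 else
                                  (if ⌊ dist G v w Data.Nat.≟ i ⌋ then [ x w 0 ] else 0))

  Optimal : Graph n → ℕ → Subset n → Subset n → (Fin n → Fin n) → (Fin n → ℕ)
          → (Fin n → ℕ → Bool) → Set
  Optimal G k D A ρ d̃ x =
    Feasible G k D A d̃ x ×
    (∀ y → Feasible G k D A d̃ y → objective A ρ d̃ x ≤ objective A ρ d̃ y)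

  Sufficient : Graph n → Subset n → (Fin n → ℕ) → (Fin n → ℕ → Bool) → Set
  Sufficient G A d̃ x = ∀ v → v ∉ A → (x v (d̃ v) ≡ false) ⊎ (ecc G v ≤ d̃ v)

  Sstar : Subset n → (Fin n → ℕ → Bool) → Subset n
  Sstar D x = Data.Vec.tabulate (λ v → not (v ∈ᵇ D) ∧ x v 0)

module Submission where

-- For a set S outside D, a vertex v ∈ A reaches S only through ρ v, so dist(v,S) = dist(ρ v,S) + 1
-- and f(S) is the ILP objective at x_{v,i} = [i = dist(v,S)].  Constraint (iii) and sufficiency
-- put every v ∉ A within the selected i of S*, so f(S*) ≤ objective(x); conversely every k-subset S′
-- of V ∖ D is encoded by a feasible solution (distances truncated at d̃) of objective ≤ f(S′).  Any
-- k-set S can be moved into V ∖ D without increasing f by replacing each vertex with a dominator: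
-- f(S) + |S| = Σᵤ max(dist(u,S),1), and dominators do not increase these maxima.

open import Defs
open import Algebra.Properties.CommutativeSemigroup using (interchange)
open import Data.Bool using (Bool; true; false; _∧_; _∨_; not; if_then_else_)
import Data.Bool as Bool
open import Data.Bool.ListAction using (any)
open import Data.Bool.Properties using (¬-not; not-injective)
open import Data.Empty using (⊥-elim)
open import Data.Fin using (Fin; zero; suc; _≟_)
import Data.Fin.Properties as Fin
open import Data.Fin.Subset using (Subset; _∈_; _∉_; _⊆_; ∣_∣; ∁; ⁅_⁆; _∪_) renaming (⊥ to ∅)
open import Data.Fin.Subset.Properties
  using (_∈?_; ∉⊥; ∣⊥∣≡0; x∈⁅x⁆; x∈⁅y⁆⇒x≡y; ∣⁅x⁆∣≡1; x∈p∪q⁺; x∈p∪q⁻; x∈∁p⇒x∉p; x∉p⇒x∈∁p;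
         ⊆-refl; s⊆s; out⊆; in⊆in; drop-∷-⊆; p⊆q⇒∣p∣≤∣q∣)
open import Data.List.Base as L using ([]; _∷_; allFin; upTo)
open import Data.List.Membership.Propositional using () renaming (_∈_ to _∈ₗ_)
open import Data.List.Membership.Propositional.Properties using (∈-allFin; ∈-upTo⁺; ∈-upTo⁻)
open import Data.List.Properties using (map-cong; map-tabulate)
open import Data.List.Relation.Unary.All as All using (All; []; _∷_)
open import Data.List.Relation.Unary.AllPairs using (_∷_)
open import Data.List.Relation.Unary.Any using (here; there)
open import Data.List.Relation.Unary.Unique.Propositional using (Unique)
open import Data.List.Relation.Unary.Unique.Propositional.Properties using (allFin⁺; upTo⁺)
open import Data.Nat as ℕ
  using (ℕ; zero; suc; _+_; _*_; _≤_; _<_; _⊔_; _⊓_; z≤n; s≤s; _≤?_; _≤′_; ≤′-refl; ≤′-step)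
open import Data.Nat.ListAction using () renaming (sum to sumL)
open import Data.Nat.Properties hiding (_≟_)
open import Data.Product using (Σ; ∃; _×_; _,_; proj₁; proj₂)
open import Data.Sum using (_⊎_; inj₁; inj₂; map₂)
open import Data.Vec using (_∷_; []; here; there)
open import Data.Vec.Properties using ([]=⇒lookup; lookup⇒[]=; lookup∘tabulate)
open import Function using (_∘_; id)
open import Relation.Binary.Definitions using (DecidableEquality)
open import Relation.Binary.PropositionalEquality
open import Relation.Nullary using (yes; no)
open import Relation.Nullary.Decidable using (⌊_⌋; _×-dec_)

private
  variable
    A B : Set

-- Defs' [_] without its vertex-count parameter, which could never be inferred.  For the same reason
-- the lemmas about sumUpTo d f below are stated for its unfolding sumL (L.map f (upTo (suc d))).
ι : Bool → ℕ
ι b = if b then 1 else 0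

ι≤1 : ∀ b → ι b ≤ 1
ι≤1 true  = ≤-refl
ι≤1 false = z≤n

ι-mono : ∀ {a b} → (a ≡ true → b ≡ true) → ι a ≤ ι b
ι-mono {true}  a⇒b rewrite a⇒b refl = ≤-refl
ι-mono {false} _ = z≤n

ι≥1⇒≡true : ∀ {b} → 1 ≤ ι b → b ≡ true
ι≥1⇒≡true {true} _ = refl

true≢false : true ≢ false
true≢false ()

∨-≡trueˡ : ∀ {a b} → a ≡ true → a ∨ b ≡ true
∨-≡trueˡ refl = refl

∨-≡trueʳ : ∀ a {b} → b ≡ true → a ∨ b ≡ true
∨-≡trueʳ true  _    = refl
∨-≡trueʳ false refl = refl

∨-≡true⁻ : ∀ a {b} → a ∨ b ≡ true → a ≡ true ⊎ b ≡ true
∨-≡true⁻ true  _ = inj₁ refl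
∨-≡true⁻ false e = inj₂ e

∧-≡true⁻ : ∀ {a b} → a ∧ b ≡ true → a ≡ true × b ≡ true
∧-≡true⁻ {true} {true} _ = refl , refl

⌊≟⌋-refl : (_≟ₐ_ : DecidableEquality A) (x : A) → ⌊ x ≟ₐ x ⌋ ≡ true
⌊≟⌋-refl _≟ₐ_ x with x ≟ₐ x
... | yes _   = refl
... | no  x≢x = ⊥-elim (x≢x refl)

⌊≟⌋-≡true⁻ : ∀ (_≟ₐ_ : DecidableEquality A) {x y} → ⌊ x ≟ₐ y ⌋ ≡ true → x ≡ y
⌊≟⌋-≡true⁻ _≟ₐ_ {x} {y} e with x ≟ₐ y
... | yes x≡y = x≡y

∈ᵇ⇒∈ : ∀ {n} {v : Fin n} {S} → v ∈ᵇ S ≡ true → v ∈ S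
∈ᵇ⇒∈ {v = v} {S} = lookup⇒[]= v S

∈⇒∈ᵇ : ∀ {n} {v : Fin n} {S} → v ∈ S → v ∈ᵇ S ≡ true
∈⇒∈ᵇ = []=⇒lookup

∉⇒∈ᵇ : ∀ {n} {v : Fin n} {S} → v ∉ S → v ∈ᵇ S ≡ false
∉⇒∈ᵇ v∉S = ¬-not (v∉S ∘ ∈ᵇ⇒∈)

∈ᵇ⇒∉ : ∀ {n} {v : Fin n} {S} → v ∈ᵇ S ≡ false → v ∉ S
∈ᵇ⇒∉ e v∈S = true≢false (trans (sym (∈⇒∈ᵇ v∈S)) e)

-- Sums, minima and maxima

sum-map-cong : ∀ {f g : A → ℕ} xs → (∀ x → f x ≡ g x) → sumL (L.map f xs) ≡ sumL (L.map g xs)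
sum-map-cong xs f≗g = cong sumL (map-cong f≗g xs)

sum-map-mono : ∀ {f g : A → ℕ} xs → (∀ x → f x ≤ g x) → sumL (L.map f xs) ≤ sumL (L.map g xs)
sum-map-mono []       f≤g = z≤n
sum-map-mono (x ∷ xs) f≤g = +-mono-≤ (f≤g x) (sum-map-mono xs f≤g)

sum-map-< : ∀ {f g : A → ℕ} {x xs} → (∀ y → f y ≤ g y) → x ∈ₗ xs → f x < g x →
            sumL (L.map f xs) < sumL (L.map g xs)
sum-map-< {xs = _ ∷ xs} f≤g (here refl)  fx<gx = +-mono-<-≤ fx<gx (sum-map-mono xs f≤g)
sum-map-< {xs = y ∷ _}  f≤g (there x∈xs) fx<gx = +-mono-≤-< (f≤g y) (sum-map-< f≤g x∈xs fx<gx)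

sum-map-≥ : ∀ (f : A → ℕ) {x xs} → x ∈ₗ xs → f x ≤ sumL (L.map f xs)
sum-map-≥ f (here refl)                = m≤m+n _ _
sum-map-≥ f {xs = y ∷ _} (there x∈xs) = ≤-trans (sum-map-≥ f x∈xs) (m≤n+m _ (f y))

sum-map-zero : ∀ {f : A → ℕ} xs → All (λ x → f x ≡ 0) xs → sumL (L.map f xs) ≡ 0
sum-map-zero []       []            = refl
sum-map-zero (x ∷ xs) (fx≡0 ∷ f≡0) = cong₂ _+_ fx≡0 (sum-map-zero xs f≡0)

sum-map-+ : ∀ (f g : A → ℕ) xs →
            sumL (L.map (λ x → f x + g x) xs) ≡ sumL (L.map f xs) + sumL (L.map g xs)
sum-map-+ f g []       = refl
sum-map-+ f g (x ∷ xs) = begin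
  f x + g x + sumL (L.map (λ x → f x + g x) xs)       ≡⟨ cong (f x + g x +_) (sum-map-+ f g xs) ⟩
  f x + g x + (sumL (L.map f xs) + sumL (L.map g xs)) ≡⟨ interchange +-commutativeSemigroup (f x) (g x) _ _ ⟩
  f x + sumL (L.map f xs) + (g x + sumL (L.map g xs)) ∎
  where open ≡-Reasoning

sum-map-*ʳ : ∀ (f : A → ℕ) c xs → sumL (L.map (λ x → f x * c) xs) ≡ sumL (L.map f xs) * c
sum-map-*ʳ f c []       = refl
sum-map-*ʳ f c (x ∷ xs) = trans (cong (f x * c +_) (sum-map-*ʳ f c xs)) (sym (*-distribʳ-+ c (f x) _))

sum-map-pos : ∀ (f : A → ℕ) xs → 1 ≤ sumL (L.map f xs) → ∃ λ x → x ∈ₗ xs × 1 ≤ f x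
sum-map-pos f (x ∷ xs) pos with f x in fx≡
... | suc _ = x , here refl , subst (1 ≤_) (sym fx≡) (s≤s z≤n)
... | zero  with sum-map-pos f xs pos
...   | y , y∈xs , fy≥1 = y , there y∈xs , fy≥1

sum-map-support : ∀ (f : A → ℕ) {x xs} → Unique xs → x ∈ₗ xs → (∀ y → y ≢ x → f y ≡ 0) →
                  sumL (L.map f xs) ≡ f x
sum-map-support f (x∉xs ∷ _) (here refl) off =
  trans (cong (f _ +_) (sum-map-zero _ (All.map (λ x≢y → off _ (x≢y ∘ sym)) x∉xs))) (+-identityʳ _)
sum-map-support f {x} {y ∷ _} (y∉xs ∷ uniq) (there x∈xs) off =
  cong₂ _+_ (off y (λ y≡x → All.lookup y∉xs x∈xs y≡x)) (sum-map-support f uniq x∈xs off)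

sum-map-indicator : ∀ (_≟ₐ_ : DecidableEquality A) (c : A → ℕ) {x xs} → Unique xs → x ∈ₗ xs →
                    sumL (L.map (λ y → ι ⌊ x ≟ₐ y ⌋ * c y) xs) ≡ c x
sum-map-indicator _≟ₐ_ c {x} {xs} uniq x∈xs = begin
  sumL (L.map (λ y → ι ⌊ x ≟ₐ y ⌋ * c y) xs) ≡⟨ sum-map-support (λ y → ι ⌊ x ≟ₐ y ⌋ * c y) uniq x∈xs off ⟩
  ι ⌊ x ≟ₐ x ⌋ * c x                        ≡⟨ cong (λ b → ι b * c x) (⌊≟⌋-refl _≟ₐ_ x) ⟩
  1 * c x                                   ≡⟨ *-identityˡ (c x) ⟩
  c x                                       ∎
  where
  open ≡-Reasoning
  off : ∀ y → y ≢ x → ι ⌊ x ≟ₐ y ⌋ * c y ≡ 0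
  off y y≢x with x ≟ₐ y
  ... | yes refl = ⊥-elim (y≢x refl)
  ... | no  _    = refl

sum-map-swap : ∀ (g : A → B → ℕ) xs ys →
  sumL (L.map (λ x → sumL (L.map (g x) ys)) xs) ≡ sumL (L.map (λ y → sumL (L.map (λ x → g x y) xs)) ys)
sum-map-swap g []       ys = sym (sum-map-zero ys (All.tabulate (λ _ → refl)))
sum-map-swap g (x ∷ xs) ys = begin
  sumL (L.map (g x) ys) + sumL (L.map (λ x → sumL (L.map (g x) ys)) xs)
    ≡⟨ cong (sumL (L.map (g x) ys) +_) (sum-map-swap g xs ys) ⟩
  sumL (L.map (g x) ys) + sumL (L.map (λ y → sumL (L.map (λ x → g x y) xs)) ys)
    ≡⟨ sym (sum-map-+ (g x) _ ys) ⟩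
  sumL (L.map (λ y → g x y + sumL (L.map (λ x → g x y) xs)) ys) ∎
  where open ≡-Reasoning

foldr-⊔-≥ : ∀ (f : A → ℕ) {x xs} → x ∈ₗ xs → f x ≤ L.foldr _⊔_ 0 (L.map f xs)
foldr-⊔-≥ f (here refl)                = m≤m⊔n _ _
foldr-⊔-≥ f {xs = y ∷ _} (there x∈xs) = ≤-trans (foldr-⊔-≥ f x∈xs) (m≤n⊔m (f y) _)

foldr-⊓-≤ : ∀ (f : A → ℕ) b {x xs} → x ∈ₗ xs → L.foldr _⊓_ b (L.map f xs) ≤ f x
foldr-⊓-≤ f b (here refl)                = m⊓n≤m _ _
foldr-⊓-≤ f b {xs = y ∷ _} (there x∈xs) = ≤-trans (m⊓n≤n (f y) _) (foldr-⊓-≤ f b x∈xs)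

foldr-⊓-≤-init : ∀ (f : A → ℕ) b xs → L.foldr _⊓_ b (L.map f xs) ≤ b
foldr-⊓-≤-init f b []       = ≤-refl
foldr-⊓-≤-init f b (x ∷ xs) = ≤-trans (m⊓n≤n (f x) _) (foldr-⊓-≤-init f b xs)

foldr-⊓-attained : ∀ (f : A → ℕ) b xs →
  L.foldr _⊓_ b (L.map f xs) ≡ b ⊎ ∃ λ x → L.foldr _⊓_ b (L.map f xs) ≡ f x
foldr-⊓-attained f b []       = inj₁ refl
foldr-⊓-attained f b (x ∷ xs) with ⊓-sel (f x) (L.foldr _⊓_ b (L.map f xs))
... | inj₁ ≡fx = inj₂ (x , ≡fx)
... | inj₂ ≡rest with foldr-⊓-attained f b xs
...   | inj₁ ≡b        = inj₁ (trans ≡rest ≡b)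
...   | inj₂ (y , ≡fy) = inj₂ (y , trans ≡rest ≡fy)

any-≡true⁺ : ∀ (p : A → Bool) {x xs} → x ∈ₗ xs → p x ≡ true → any p xs ≡ true
any-≡true⁺ p (here refl)                px = ∨-≡trueˡ px
any-≡true⁺ p {xs = y ∷ _} (there x∈xs) px = ∨-≡trueʳ (p y) (any-≡true⁺ p x∈xs px)

any-≡true⁻ : ∀ (p : A → Bool) xs → any p xs ≡ true → ∃ λ x → p x ≡ true
any-≡true⁻ p (x ∷ xs) e with ∨-≡true⁻ (p x) e
... | inj₁ px   = x , px
... | inj₂ rest = any-≡true⁻ p xs rest

sumV-suc : ∀ {n} (f : Fin (suc n) → ℕ) → sumV f ≡ f zero + sumV (f ∘ suc)
sumV-suc {n} f = cong (λ xs → f zero + sumL xs)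
  (trans (map-tabulate suc f) (sym (map-tabulate id (f ∘ suc))))

sumV-fibres : ∀ {n m} (p : Fin n → Bool) (φ : Fin n → Fin m) (h : Fin m → ℕ) →
  sumV (λ v → if p v then h (φ v) else 0) ≡ sumV (λ u → sumV (λ v → ι (p v ∧ ⌊ φ v ≟ u ⌋)) * h u)
sumV-fibres {n} {m} p φ h = begin
  sumV (λ v → if p v then h (φ v) else 0)
    ≡⟨ sum-map-cong (allFin n) (λ v → pointwise v (p v)) ⟨
  sumV (λ v → sumV (λ u → ι (p v ∧ ⌊ φ v ≟ u ⌋) * h u))
    ≡⟨ sum-map-swap (λ v u → ι (p v ∧ ⌊ φ v ≟ u ⌋) * h u) (allFin n) (allFin m) ⟩
  sumV (λ u → sumV (λ v → ι (p v ∧ ⌊ φ v ≟ u ⌋) * h u))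
    ≡⟨ sum-map-cong (allFin m) (λ u → sum-map-*ʳ (λ v → ι (p v ∧ ⌊ φ v ≟ u ⌋)) (h u) (allFin n)) ⟩
  sumV (λ u → sumV (λ v → ι (p v ∧ ⌊ φ v ≟ u ⌋)) * h u) ∎
  where
  open ≡-Reasoning
  pointwise : ∀ v b → sumV (λ u → ι (b ∧ ⌊ φ v ≟ u ⌋) * h u) ≡ (if b then h (φ v) else 0)
  pointwise v true  = sum-map-indicator _≟_ h (allFin⁺ m) (∈-allFin (φ v))
  pointwise v false = sum-map-zero (allFin m) (All.tabulate (λ _ → refl))

sumUpTo-≥ : ∀ (f : ℕ → ℕ) {j d} → j ≤ d → f j ≤ sumL (L.map f (upTo (suc d)))
sumUpTo-≥ f j≤d = sum-map-≥ f (∈-upTo⁺ (s≤s j≤d))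

sumUpTo-pos : ∀ (f : ℕ → ℕ) d → 1 ≤ sumL (L.map f (upTo (suc d))) → ∃ λ j → j ≤ d × 1 ≤ f j
sumUpTo-pos f d pos with j , j∈ , fj≥1 ← sum-map-pos f (upTo (suc d)) pos = j , ≤-pred (∈-upTo⁻ j∈) , fj≥1

sumUpTo-indicator : ∀ (c : ℕ → ℕ) {j d} → j ≤ d → sumL (L.map (λ i → ι ⌊ j ℕ.≟ i ⌋ * c i) (upTo (suc d))) ≡ c j
sumUpTo-indicator c j≤d = sum-map-indicator ℕ._≟_ c (upTo⁺ _) (∈-upTo⁺ (s≤s j≤d))

sumV-1 : ∀ n → sumV {n} (λ _ → 1) ≡ n
sumV-1 zero    = refl
sumV-1 (suc n) = trans (sumV-suc {n} (λ _ → 1)) (cong suc (sumV-1 n))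

inhabited⇒suc : ∀ {n} → Fin n → ∃ λ m → n ≡ suc m
inhabited⇒suc {suc m} _ = m , refl

-- Subsets

∣∣≡sumV : ∀ {n} (S : Subset n) → ∣ S ∣ ≡ sumV (λ v → ι (v ∈ᵇ S))
∣∣≡sumV []          = refl
∣∣≡sumV (true ∷ S)  = trans (cong suc (∣∣≡sumV S)) (sym (sumV-suc (λ v → ι (v ∈ᵇ (true ∷ S)))))
∣∣≡sumV (false ∷ S) = trans (∣∣≡sumV S) (sym (sumV-suc (λ v → ι (v ∈ᵇ (false ∷ S)))))

∣∣≥1⇒nonempty : ∀ {n} (S : Subset n) → 1 ≤ ∣ S ∣ → ∃ λ s → s ∈ S
∣∣≥1⇒nonempty (true ∷ S)  _ = zero , here
∣∣≥1⇒nonempty (false ∷ S) p with s , s∈S ← ∣∣≥1⇒nonempty S p = suc s , there s∈S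

∣p∪q∣≤∣p∣+∣q∣ : ∀ {n} (p q : Subset n) → ∣ p ∪ q ∣ ≤ ∣ p ∣ + ∣ q ∣
∣p∪q∣≤∣p∣+∣q∣ []          []          = z≤n
∣p∪q∣≤∣p∣+∣q∣ (true ∷ p)  (true ∷ q)  = s≤s (≤-trans (∣p∪q∣≤∣p∣+∣q∣ p q) (+-monoʳ-≤ ∣ p ∣ (n≤1+n _)))
∣p∪q∣≤∣p∣+∣q∣ (true ∷ p)  (false ∷ q) = s≤s (∣p∪q∣≤∣p∣+∣q∣ p q)
∣p∪q∣≤∣p∣+∣q∣ (false ∷ p) (true ∷ q)  = subst (suc ∣ p ∪ q ∣ ≤_) (sym (+-suc ∣ p ∣ ∣ q ∣)) (s≤s (∣p∪q∣≤∣p∣+∣q∣ p q))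
∣p∪q∣≤∣p∣+∣q∣ (false ∷ p) (false ∷ q) = ∣p∪q∣≤∣p∣+∣q∣ p q

image : ∀ {n m} → (Fin n → Fin m) → Subset n → Subset m
image f []          = ∅
image f (true ∷ S)  = ⁅ f zero ⁆ ∪ image (f ∘ suc) S
image f (false ∷ S) = image (f ∘ suc) S

∣image∣≤∣∣ : ∀ {n m} (f : Fin n → Fin m) S → ∣ image f S ∣ ≤ ∣ S ∣
∣image∣≤∣∣ {m = m} f []  = ≤-reflexive (∣⊥∣≡0 m)
∣image∣≤∣∣ f (true ∷ S)  = begin
  ∣ ⁅ f zero ⁆ ∪ image (f ∘ suc) S ∣         ≤⟨ ∣p∪q∣≤∣p∣+∣q∣ ⁅ f zero ⁆ _ ⟩
  ∣ ⁅ f zero ⁆ ∣ + ∣ image (f ∘ suc) S ∣     ≡⟨ cong (_+ ∣ image (f ∘ suc) S ∣) (∣⁅x⁆∣≡1 (f zero)) ⟩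
  suc ∣ image (f ∘ suc) S ∣                  ≤⟨ s≤s (∣image∣≤∣∣ (f ∘ suc) S) ⟩
  suc ∣ S ∣                                  ∎
  where open ≤-Reasoning
∣image∣≤∣∣ f (false ∷ S) = ∣image∣≤∣∣ (f ∘ suc) S

∈-image : ∀ {n m} (f : Fin n → Fin m) {x S} → x ∈ S → f x ∈ image f S
∈-image f                  here        = x∈p∪q⁺ (inj₁ (x∈⁅x⁆ (f zero)))
∈-image f {S = true ∷ S}  (there x∈S) = x∈p∪q⁺ (inj₂ (∈-image (f ∘ suc) x∈S))
∈-image f {S = false ∷ S} (there x∈S) = ∈-image (f ∘ suc) x∈S

image⊆ : ∀ {n m} (f : Fin n → Fin m) {S U} → (∀ {x} → x ∈ S → f x ∈ U) → image f S ⊆ U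
image⊆ f {[]}        _  y∈∅ = ⊥-elim (∉⊥ y∈∅)
image⊆ f {true ∷ S}  f∈U y∈ with x∈p∪q⁻ ⁅ f zero ⁆ _ y∈
... | inj₁ y∈⁅fzero⁆ rewrite x∈⁅y⁆⇒x≡y (f zero) y∈⁅fzero⁆ = f∈U here
... | inj₂ y∈image   = image⊆ (f ∘ suc) (f∈U ∘ there) y∈image
image⊆ f {false ∷ S} f∈U y∈ = image⊆ (f ∘ suc) (f∈U ∘ there) y∈

⊆-interpolate : ∀ {n} k {T U : Subset n} → T ⊆ U → ∣ T ∣ ≤ k → k ≤ ∣ U ∣ →
                ∃ λ T′ → T ⊆ T′ × T′ ⊆ U × ∣ T′ ∣ ≡ k
⊆-interpolate k {[]} {[]} _ _ k≤0 = [] , ⊆-refl , ⊆-refl , sym (n≤0⇒n≡0 k≤0)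
⊆-interpolate k {true ∷ T} {false ∷ U} T⊆U _ _ with () ← T⊆U here
⊆-interpolate (suc k) {true ∷ T} {true ∷ U} T⊆U (s≤s ∣T∣≤k) (s≤s k≤∣U∣)
  with T′ , T⊆T′ , T′⊆U , ∣T′∣≡k ← ⊆-interpolate k (drop-∷-⊆ T⊆U) ∣T∣≤k k≤∣U∣
  = true ∷ T′ , in⊆in T⊆T′ , in⊆in T′⊆U , cong suc ∣T′∣≡k
⊆-interpolate k {false ∷ T} {false ∷ U} T⊆U ∣T∣≤k k≤∣U∣
  with T′ , T⊆T′ , T′⊆U , ∣T′∣≡k ← ⊆-interpolate k (drop-∷-⊆ T⊆U) ∣T∣≤k k≤∣U∣
  = false ∷ T′ , s⊆s T⊆T′ , s⊆s T′⊆U , ∣T′∣≡k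
⊆-interpolate k {false ∷ T} {true ∷ U} T⊆U ∣T∣≤k k≤1+∣U∣ with k ≤? ∣ U ∣
... | yes k≤∣U∣
  with T′ , T⊆T′ , T′⊆U , ∣T′∣≡k ← ⊆-interpolate k (drop-∷-⊆ T⊆U) ∣T∣≤k k≤∣U∣
  = false ∷ T′ , s⊆s T⊆T′ , out⊆ T′⊆U , ∣T′∣≡k
... | no k≰∣U∣ with k | ≤-antisym k≤1+∣U∣ (≰⇒> k≰∣U∣)
...   | .(suc ∣ U ∣) | refl
  with T′ , T⊆T′ , T′⊆U , ∣T′∣≡∣U∣ ← ⊆-interpolate ∣ U ∣ (drop-∷-⊆ T⊆U) (p⊆q⇒∣p∣≤∣q∣ (drop-∷-⊆ T⊆U)) ≤-refl
  = true ∷ T′ , out⊆ T⊆T′ , in⊆in T′⊆U , cong suc ∣T′∣≡∣U∣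

module Walks {n : ℕ} (G : Graph n) where

  adj-sym′ : ∀ {u v} → adj G u v ≡ true → adj G v u ≡ true
  adj-sym′ {u} {v} = trans (adj-sym G v u)

  -- A record, so that the endpoints can be inferred.
  record Within (i : ℕ) (u v : Fin n) : Set where
    constructor within✓
    field holds : within G i u v ≡ true
  open Within public

  within-zero⁻ : ∀ {u v} → Within 0 u v → u ≡ v
  within-zero⁻ (within✓ e) = ⌊≟⌋-≡true⁻ _≟_ e

  within-refl : ∀ u → Within 0 u u
  within-refl u = within✓ (⌊≟⌋-refl _≟_ u)

  within-suc : ∀ {i u v} → Within i u v → Within (suc i) u v
  within-suc (within✓ e) = within✓ (∨-≡trueˡ e)

  within-mono : ∀ {i j u v} → i ≤ j → Within i u v → Within j u v
  within-mono i≤j = go (≤⇒≤′ i≤j)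
    where
    go : ∀ {i j u v} → i ≤′ j → Within i u v → Within j u v
    go ≤′-refl        w = w
    go (≤′-step i≤′j) w = within-suc (go i≤′j w)

  within-cons : ∀ {i u w v} → adj G u w ≡ true → Within i w v → Within (suc i) u v
  within-cons {i} {u} {w} {v} uw (within✓ e) =
    within✓ (∨-≡trueʳ (within G i u v) (any-≡true⁺ (λ w′ → adj G u w′ ∧ within G i w′ v) (∈-allFin w) (cong₂ _∧_ uw e)))

  within-suc⁻ : ∀ {i u v} → Within (suc i) u v →
                Within i u v ⊎ ∃ λ w → adj G u w ≡ true × Within i w v
  within-suc⁻ {i} {u} {v} (within✓ e) with ∨-≡true⁻ (within G i u v) e
  ... | inj₁ short = inj₁ (within✓ short)
  ... | inj₂ via   with w , uw∧wv ← any-≡true⁻ (λ w → adj G u w ∧ within G i w v) (allFin n) via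
    = inj₂ (w , proj₁ (∧-≡true⁻ uw∧wv) , within✓ (proj₂ (∧-≡true⁻ uw∧wv)))

  within-snoc : ∀ {i u w v} → Within i u w → adj G w v ≡ true → Within (suc i) u v
  within-snoc {zero} uw wv with refl ← within-zero⁻ uw = within-cons wv (within-refl _)
  within-snoc {suc i} uw wv with within-suc⁻ uw
  ... | inj₁ short              = within-suc (within-snoc short wv)
  ... | inj₂ (p , up , pw)      = within-cons up (within-snoc pw wv)

  within-sym : ∀ {i u v} → Within i u v → Within i v u
  within-sym {zero} uv with refl ← within-zero⁻ uv = uv
  within-sym {suc i} uv with within-suc⁻ uv
  ... | inj₁ short         = within-suc (within-sym short)
  ... | inj₂ (w , uw , wv) = within-snoc (within-sym wv) (adj-sym′ uw)

  within-suc⁻ʳ : ∀ {i u v} → Within (suc i) u v →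
                 Within i u v ⊎ ∃ λ w → Within i u w × adj G w v ≡ true
  within-suc⁻ʳ uv with within-suc⁻ (within-sym uv)
  ... | inj₁ short         = inj₁ (within-sym short)
  ... | inj₂ (w , vw , wu) = inj₂ (w , within-sym wu , adj-sym′ vw)

  Reach⇒Within : ∀ {P : Fin n → Set} {u v} → Reach G P u v → ∃ λ i → Within i u v
  Reach⇒Within (here _)        = 0 , within-refl _
  Reach⇒Within (step _ uw wv) with i , w ← Reach⇒Within wv = suc i , within-cons uw w

  ball : ℕ → Fin n → ℕ
  ball i u = sumV (λ v → ι (within G i u v))

  Saturated : ℕ → Fin n → Set
  Saturated i u = ∀ v → Within (suc i) u v → Within i u v

  saturated-suc : ∀ {i u} → Saturated i u → Saturated (suc i) u
  saturated-suc sat v uv with within-suc⁻ʳ uv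
  ... | inj₁ short         = short
  ... | inj₂ (w , uw , wv) = within-snoc (sat w uw) wv

  saturated-absorbs : ∀ {i j u} → Saturated i u → i ≤′ j → ∀ v → Within j u v → Within i u v
  saturated-absorbs sat ≤′-refl        v uv = uv
  saturated-absorbs sat (≤′-step i≤′j) v uv =
    saturated-absorbs sat i≤′j v (iterate i≤′j v uv)
    where
    iterate : ∀ {j} → _ ≤′ j → Saturated j _
    iterate ≤′-refl        = sat
    iterate (≤′-step i≤′j) = saturated-suc (iterate i≤′j)

  saturated-or-grows : ∀ u i → Saturated i u ⊎ suc i ≤ ball i u
  saturated-or-grows u zero =
    inj₂ (≤-trans (≤-reflexive (cong ι (sym (holds (within-refl u)))))
                  (sum-map-≥ (λ v → ι (within G 0 u v)) (∈-allFin u)))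
  saturated-or-grows u (suc i) with saturated-or-grows u i
  ... | inj₁ sat = inj₁ (saturated-suc sat)
  ... | inj₂ grows with Fin.any? (λ v → (within G (suc i) u v Bool.≟ true) ×-dec (within G i u v Bool.≟ false))
  ...   | yes (v , new , old) =
    inj₂ (≤-trans (s≤s grows) (sum-map-< (λ w → ι-mono (holds ∘ within-suc {i} {u} {w} ∘ within✓)) (∈-allFin v) fresh))
    where
    fresh : ι (within G i u v) < ι (within G (suc i) u v)
    fresh rewrite new | old = ≤-refl
  ...   | no none = inj₁ (saturated-suc sat)
    where
    sat : Saturated i u
    sat v (within✓ uv) with within G i u v Bool.≟ true
    ... | yes old = within✓ old
    ... | no  new = ⊥-elim (none (v , uv , ¬-not new))

  -- A ball that stops growing stays fixed, and a ball has at most n vertices, so radius n − 1 suffices.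
  within-diameter : Connected G → ∀ {m} → n ≡ suc m → ∀ u v → Within m u v
  within-diameter conn {m} refl u v with saturated-or-grows u m
  ... | inj₁ sat with j , uv ← Reach⇒Within (conn u v) with j ≤? m
  ...   | yes j≤m = within-mono j≤m uv
  ...   | no  j≰m = saturated-absorbs sat (≤⇒≤′ (<⇒≤ (≰⇒> j≰m))) v uv
  within-diameter conn {m} refl u v | inj₂ grows with within G m u v in uv
  ... | true  = within✓ uv
  ... | false = ⊥-elim (<-irrefl refl (≤-<-trans grows (subst (ball m u <_) (sumV-1 (suc m))
        (sum-map-< (λ w → ι≤1 (within G m u w)) (∈-allFin v) (subst (λ b → ι b < 1) (sym uv) ≤-refl)))))

module Distance {n : ℕ} (G : Graph n) (conn : Connected G) where

  open Walks G public

  distSearch-≤ : ∀ f i {j u v} → i ≤ j → Within j u v → distSearch G f i u v ≤ j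
  distSearch-≤ zero    i i≤j _ = i≤j
  distSearch-≤ (suc f) i {j} {u} {v} i≤j uv with within G i u v in found | i ℕ.≟ j
  ... | true  | _        = i≤j
  ... | false | yes refl = ⊥-elim (true≢false (trans (sym (holds uv)) found))
  ... | false | no  i≢j  = distSearch-≤ f (suc i) (≤∧≢⇒< i≤j i≢j) uv

  distSearch-found : ∀ f i {j u v} → i ≤ j → j < i + f → Within j u v → Within (distSearch G f i u v) u v
  distSearch-found zero    i {j} i≤j j<i+0 _ = ⊥-elim (<-irrefl refl (≤-<-trans i≤j (subst (j <_) (+-identityʳ i) j<i+0)))
  distSearch-found (suc f) i {j} {u} {v} i≤j j<i+f uv with within G i u v in found | i ℕ.≟ j
  ... | true  | _        = within✓ found
  ... | false | yes refl = ⊥-elim (true≢false (trans (sym (holds uv)) found))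
  ... | false | no  i≢j  = distSearch-found f (suc i) (≤∧≢⇒< i≤j i≢j) (subst (j <_) (+-suc i f) j<i+f) uv

  dist-≤ : ∀ {j u v} → Within j u v → dist G u v ≤ j
  dist-≤ = distSearch-≤ n 0 z≤n

  dist-within : ∀ u v → Within (dist G u v) u v
  dist-within u v with m , n≡1+m ← inhabited⇒suc u =
    distSearch-found n 0 z≤n (subst (m <_) (sym n≡1+m) ≤-refl) (within-diameter conn n≡1+m u v)

  dist<n : ∀ u v → dist G u v < n
  dist<n u v with m , n≡1+m ← inhabited⇒suc u =
    subst (dist G u v <_) (sym n≡1+m) (s≤s (dist-≤ (within-diameter conn n≡1+m u v)))

  dist-sym : ∀ u v → dist G u v ≡ dist G v u
  dist-sym u v = ≤-antisym (dist-≤ (within-sym (dist-within v u))) (dist-≤ (within-sym (dist-within u v)))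

  dist≡0⇒≡ : ∀ {u v} → dist G u v ≡ 0 → u ≡ v
  dist≡0⇒≡ {u} {v} d≡0 = within-zero⁻ (subst (λ i → Within i u v) d≡0 (dist-within u v))

  dist-refl : ∀ u → dist G u u ≡ 0
  dist-refl u = n≤0⇒n≡0 (dist-≤ (within-refl u))

  private
    candidate : Fin n → Subset n → Fin n → ℕ
    candidate u S s = if s ∈ᵇ S then dist G u s else n

  distSet-≤ : ∀ {u s S} → s ∈ S → distSet G u S ≤ dist G u s
  distSet-≤ {u} {s} {S} s∈S with s ∈ᵇ S in s∈ᵇS | foldr-⊓-≤ (candidate u S) n (∈-allFin s)
  ... | true  | ≤candidate = ≤candidate
  ... | false | _          = ⊥-elim (∈ᵇ⇒∉ s∈ᵇS s∈S)

  distSet-≤n : ∀ u S → distSet G u S ≤ n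
  distSet-≤n u S = foldr-⊓-≤-init (candidate u S) n (allFin n)

  distSet-cases : ∀ u S → distSet G u S ≡ n ⊎ ∃ λ s → s ∈ S × distSet G u S ≡ dist G u s
  distSet-cases u S with foldr-⊓-attained (candidate u S) n (allFin n)
  ... | inj₁ ≡n = inj₁ ≡n
  ... | inj₂ (s , ≡cand) with s ∈ᵇ S in s∈ᵇS
  ...   | true  = inj₂ (s , ∈ᵇ⇒∈ s∈ᵇS , ≡cand)
  ...   | false = inj₁ ≡cand

  distSet-attained : ∀ {u s₀ S} → s₀ ∈ S → ∃ λ s → s ∈ S × distSet G u S ≡ dist G u s
  distSet-attained {u} {s₀} {S} s₀∈S with distSet-cases u S
  ... | inj₂ attained = attained
  ... | inj₁ ≡n = ⊥-elim (<-irrefl ≡n (≤-<-trans (distSet-≤ s₀∈S) (dist<n u s₀)))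

  distSet-≡0 : ∀ {u S} → u ∈ S → distSet G u S ≡ 0
  distSet-≡0 {u} u∈S = n≤0⇒n≡0 (≤-trans (distSet-≤ u∈S) (≤-reflexive (dist-refl u)))

  distSet-≥1 : ∀ {u S} → u ∉ S → 1 ≤ distSet G u S
  distSet-≥1 {u} {S} u∉S with distSet-cases u S
  ... | inj₁ ≡n with m , n≡1+m ← inhabited⇒suc u =
    subst (1 ≤_) (sym (trans ≡n n≡1+m)) (s≤s z≤n)
  ... | inj₂ (s , s∈S , ≡dist) with dist G u s in d
  ...   | suc _ = subst (1 ≤_) (sym ≡dist) (s≤s z≤n)
  ...   | zero with refl ← dist≡0⇒≡ d = ⊥-elim (u∉S s∈S)

  dominator-dist : ∀ {s′ s} → Dominates G s′ s → ∀ u → dist G s′ u ≤ dist G s u ⊔ 1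
  dominator-dist {s′} {s} s′≽s u with s ≟ u
  ... | yes refl with s′≽s s (inj₁ refl)
  ...   | inj₁ refl = ≤-trans (≤-reflexive (dist-refl s)) z≤n
  ...   | inj₂ s′s  = ≤-trans (dist-≤ (within-cons s′s (within-refl s))) (m≤n⊔m _ 1)
  dominator-dist {s′} {s} s′≽s u | no s≢u with dist G s u in d | dist-within s u
  ... | zero  | _  = ⊥-elim (s≢u (dist≡0⇒≡ d))
  ... | suc j | su with within-suc⁻ su
  ...   | inj₁ short = ⊥-elim (<-irrefl refl (≤-<-trans (dist-≤ short) (≤-reflexive (sym d))))
  ...   | inj₂ (w , sw , wu) with s′≽s w (inj₂ sw)
  ...     | inj₁ refl = ≤-trans (dist-≤ wu) (≤-trans (n≤1+n j) (m≤m⊔n _ 1))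
  ...     | inj₂ s′w  = ≤-trans (dist-≤ (within-cons s′w wu)) (m≤m⊔n _ 1)

  farness+∣∣ : ∀ T → farness G T + ∣ T ∣ ≡ sumV (λ u → distSet G u T ⊔ 1)
  farness+∣∣ T = begin
    farness G T + ∣ T ∣                                     ≡⟨ cong (farness G T +_) (∣∣≡sumV T) ⟩
    farness G T + sumV (λ u → ι (u ∈ᵇ T))                   ≡⟨ sum-map-+ (λ u → distSet G u T) _ (allFin n) ⟨
    sumV (λ u → distSet G u T + ι (u ∈ᵇ T))                 ≡⟨ sum-map-cong (allFin n) (λ u → pointwise u (u ∈ᵇ T) refl) ⟩
    sumV (λ u → distSet G u T ⊔ 1)                          ∎
    where
    open ≡-Reasoning
    pointwise : ∀ u b → u ∈ᵇ T ≡ b → distSet G u T + ι b ≡ distSet G u T ⊔ 1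
    pointwise u true  u∈T rewrite distSet-≡0 (∈ᵇ⇒∈ {S = T} u∈T) = refl
    pointwise u false u∉T = trans (+-identityʳ _) (sym (m≥n⇒m⊔n≡m (distSet-≥1 (∈ᵇ⇒∉ {S = T} u∉T))))

  farness-dominated : ∀ {S S′} → ∣ S′ ∣ ≡ ∣ S ∣ →
    (∀ {s} → s ∈ S → ∃ λ s′ → s′ ∈ S′ × Dominates G s′ s) → farness G S′ ≤ farness G S
  farness-dominated {S} {S′} ∣S′∣≡∣S∣ dominated = +-cancelʳ-≤ ∣ S ∣ _ _ (begin
    farness G S′ + ∣ S ∣                ≡⟨ cong (farness G S′ +_) ∣S′∣≡∣S∣ ⟨
    farness G S′ + ∣ S′ ∣               ≡⟨ farness+∣∣ S′ ⟩
    sumV (λ u → distSet G u S′ ⊔ 1)     ≤⟨ sum-map-mono (allFin n) pointwise ⟩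
    sumV (λ u → distSet G u S ⊔ 1)      ≡⟨ farness+∣∣ S ⟨
    farness G S + ∣ S ∣                 ∎)
    where
    open ≤-Reasoning
    pointwise : ∀ u → distSet G u S′ ⊔ 1 ≤ distSet G u S ⊔ 1
    pointwise u with distSet-cases u S
    ... | inj₁ ≡n = ⊔-monoˡ-≤ 1 (≤-trans (distSet-≤n u S′) (≤-reflexive (sym ≡n)))
    ... | inj₂ (s , s∈S , ≡dist) with s′ , s′∈S′ , s′≽s ← dominated s∈S = ⊔-lub
      (begin
        distSet G u S′    ≤⟨ distSet-≤ s′∈S′ ⟩
        dist G u s′       ≡⟨ dist-sym u s′ ⟩
        dist G s′ u       ≤⟨ dominator-dist s′≽s u ⟩
        dist G s u ⊔ 1    ≡⟨ cong (_⊔ 1) (trans (dist-sym s u) (sym ≡dist)) ⟩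
        distSet G u S ⊔ 1 ∎)
      (m≤n⊔m _ 1)

  escape : ∀ {r v a b} i → Reach G (_≢ r) v a → Within i a b →
           Reach G (_≢ r) v b ⊎ ∃ λ j → j < i × Within j r b
  escape zero va ab with refl ← within-zero⁻ ab = inj₁ va
  escape {r} (suc i) va ab with within-suc⁻ ab
  ... | inj₁ short = map₂ (λ (j , j<i , rb) → j , m<n⇒m<1+n j<i , rb) (escape i va short)
  ... | inj₂ (w , aw , wb) with w ≟ r
  ...   | yes refl = inj₂ (i , ≤-refl , wb)
  ...   | no  w≢r  = map₂ (λ (j , j<i , rb) → j , m<n⇒m<1+n j<i , rb) (escape i (Reach-snoc va aw w≢r) wb)
    where
    Reach-snoc : ∀ {P : Fin n → Set} {v a w} → Reach G P v a → adj G a w ≡ true → P w → Reach G P v w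
    Reach-snoc (here pa)        aw pw = step pa aw (here pw)
    Reach-snoc (step pv vx xa)  aw pw = step pv vx (Reach-snoc xa aw pw)

  -- Each vertex of D is replaced by a dominator outside D; the image is then padded back to size ∣ S ∣.
  farness-avoiding : ∀ D → (∀ v → v ∈ D → ∃ λ u → u ∉ D × Dominates G u v) →
    ∀ S → ∣ S ∣ ≤ ∣ ∁ D ∣ → ∃ λ S′ → S′ ⊆ ∁ D × ∣ S′ ∣ ≡ ∣ S ∣ × farness G S′ ≤ farness G S
  farness-avoiding D dominated S ∣S∣≤∣∁D∣ =
    S′ , S′⊆∁D , ∣S′∣≡∣S∣ , farness-dominated {S} ∣S′∣≡∣S∣ (λ {s} s∈S → φ s , image⊆S′ (∈-image φ s∈S) , proj₂ (proj₂ (φ-spec s)))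
    where
    φ-spec : ∀ v → ∃ λ u → u ∉ D × Dominates G u v
    φ-spec v with v ∈? D
    ... | yes v∈D = dominated v v∈D
    ... | no  v∉D = v , v∉D , λ _ w∈N[v] → w∈N[v]
    φ : Fin n → Fin n
    φ v = proj₁ (φ-spec v)
    padded : ∃ λ S′ → image φ S ⊆ S′ × S′ ⊆ ∁ D × ∣ S′ ∣ ≡ ∣ S ∣
    padded = ⊆-interpolate ∣ S ∣ (image⊆ φ {S} (λ {v} _ → x∉p⇒x∈∁p (proj₁ (proj₂ (φ-spec v)))))
                                 (∣image∣≤∣∣ φ S) ∣S∣≤∣∁D∣
    S′ : Subset n
    S′ = proj₁ padded
    image⊆S′ : image φ S ⊆ S′
    image⊆S′ = proj₁ (proj₂ padded)
    S′⊆∁D : S′ ⊆ ∁ D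
    S′⊆∁D = proj₁ (proj₂ (proj₂ padded))
    ∣S′∣≡∣S∣ : ∣ S′ ∣ ≡ ∣ S ∣
    ∣S′∣≡∣S∣ = proj₂ (proj₂ (proj₂ padded))

module ReducedILP {n : ℕ} (G : Graph n) (conn : Connected G)
  (D A : Subset n) (A⊆D : A ⊆ D) (ρ : Fin n → Fin n) (ρ∉A : ∀ v → v ∈ A → ρ v ∉ A)
  (pendant : ∀ v → v ∈ A → ∀ w → Reach G (_≢ ρ v) v w → (w ∈ D) × Dominates G (ρ v) w)
  (d̃ : Fin n → ℕ)
  where

  open Distance G conn

  cost : Fin n → ℕ → ℕ
  cost v i = alpha A ρ v * (i + 1) + i

  cost-mono : ∀ v {i j} → i ≤ j → cost v i ≤ cost v j
  cost-mono v i≤j = +-mono-≤ (*-monoʳ-≤ (alpha A ρ v) (+-monoˡ-≤ 1 i≤j)) i≤j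

  -- The ILP objective at x_{v,i} = [i = dist(v,S)], without truncation at d̃ v.
  reducedCost : Subset n → ℕ
  reducedCost S = sumV (λ v → if v ∈ᵇ A then 0 else cost v (distSet G v S))

  ≢ρ : ∀ {v} → v ∈ A → v ≢ ρ v
  ≢ρ {v} v∈A v≡ρv = ρ∉A v v∈A (subst (_∈ A) v≡ρv v∈A)

  adj-ρ : ∀ {v} → v ∈ A → adj G v (ρ v) ≡ true
  adj-ρ {v} v∈A with proj₂ (pendant v v∈A v (here (≢ρ v∈A))) v (inj₁ refl)
  ... | inj₁ v≡ρv = ⊥-elim (≢ρ v∈A v≡ρv)
  ... | inj₂ ρv-v = adj-sym′ ρv-v

  -- Every walk from v ∈ A to a set outside D leaves the pendant component through ρ v.
  distSet-pendant : ∀ {S s₀} → S ⊆ ∁ D → s₀ ∈ S → ∀ {v} → v ∈ A →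
                    distSet G v S ≡ suc (distSet G (ρ v) S)
  distSet-pendant {S} S⊆∁D s₀∈S {v} v∈A = ≤-antisym via-ρ through-ρ
    where
    via-ρ : distSet G v S ≤ suc (distSet G (ρ v) S)
    via-ρ with s , s∈S , ≡dist ← distSet-attained {ρ v} s₀∈S = begin
      distSet G v S             ≤⟨ distSet-≤ s∈S ⟩
      dist G v s                ≤⟨ dist-≤ (within-cons (adj-ρ v∈A) (dist-within (ρ v) s)) ⟩
      suc (dist G (ρ v) s)      ≡⟨ cong suc ≡dist ⟨
      suc (distSet G (ρ v) S)   ∎
      where open ≤-Reasoning
    through-ρ : suc (distSet G (ρ v) S) ≤ distSet G v S
    through-ρ with s , s∈S , ≡dist ← distSet-attained {v} s₀∈S
              with escape (dist G v s) (here (≢ρ v∈A)) (dist-within v s)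
    ... | inj₁ v⇝s = ⊥-elim (x∈∁p⇒x∉p (S⊆∁D s∈S) (proj₁ (pendant v v∈A s v⇝s)))
    ... | inj₂ (j , j<d , ρv-s) = begin
      suc (distSet G (ρ v) S)   ≤⟨ s≤s (distSet-≤ s∈S) ⟩
      suc (dist G (ρ v) s)      ≤⟨ s≤s (dist-≤ ρv-s) ⟩
      suc j                     ≤⟨ j<d ⟩
      dist G v s                ≡⟨ ≡dist ⟨
      distSet G v S             ∎
      where open ≤-Reasoning

  alpha-A : ∀ {u} → u ∈ A → alpha A ρ u ≡ 0
  alpha-A {u} u∈A = sum-map-zero (allFin n) (All.tabulate (λ {v} _ → term v))
    where
    term : ∀ v → ι ((v ∈ᵇ A) ∧ ⌊ ρ v ≟ u ⌋) ≡ 0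
    term v with v ∈ᵇ A in v∈ᵇA | ρ v ≟ u
    ... | false | _        = refl
    ... | true  | no _     = refl
    ... | true  | yes refl = ⊥-elim (ρ∉A v (∈ᵇ⇒∈ v∈ᵇA) u∈A)

  -- A vertex v ∈ A contributes dist(ρ v, S) + 1 to the farness; regrouping these by ρ v gives the α-terms.
  farness≡reducedCost : ∀ {S s₀} → S ⊆ ∁ D → s₀ ∈ S → farness G S ≡ reducedCost S
  farness≡reducedCost {S} S⊆∁D s₀∈S = begin
    sumV d
      ≡⟨ sum-map-cong (allFin n) (λ v → split v (v ∈ᵇ A) refl) ⟩
    sumV (λ v → inA v + outA v)
      ≡⟨ sum-map-+ inA outA (allFin n) ⟩
    sumV inA + sumV outA
      ≡⟨ cong (_+ sumV outA) (sumV-fibres (_∈ᵇ A) ρ h) ⟩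
    sumV (λ u → alpha A ρ u * h u) + sumV outA
      ≡⟨ cong (_+ sumV outA) (sum-map-cong (allFin n) (λ u → drop-A u (u ∈ᵇ A) refl)) ⟩
    sumV (λ u → if u ∈ᵇ A then 0 else alpha A ρ u * h u) + sumV outA
      ≡⟨ sum-map-+ (λ u → if u ∈ᵇ A then 0 else alpha A ρ u * h u) outA (allFin n) ⟨
    sumV (λ v → (if v ∈ᵇ A then 0 else alpha A ρ v * h v) + outA v)
      ≡⟨ sum-map-cong (allFin n) (λ v → merge (v ∈ᵇ A)) ⟩
    reducedCost S ∎
    where
    open ≡-Reasoning
    d : Fin n → ℕ
    d v = distSet G v S
    h : Fin n → ℕ
    h u = d u + 1
    inA outA : Fin n → ℕ
    inA  v = if v ∈ᵇ A then h (ρ v) else 0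
    outA v = if v ∈ᵇ A then 0 else d v
    split : ∀ v b → v ∈ᵇ A ≡ b → d v ≡ (if b then h (ρ v) else 0) + (if b then 0 else d v)
    split v true  v∈A = trans (distSet-pendant S⊆∁D s₀∈S (∈ᵇ⇒∈ v∈A)) (trans (+-comm 1 _) (sym (+-identityʳ _)))
    split v false _   = refl
    drop-A : ∀ u b → u ∈ᵇ A ≡ b → alpha A ρ u * h u ≡ (if b then 0 else alpha A ρ u * h u)
    drop-A u true  u∈A = cong (_* h u) (alpha-A (∈ᵇ⇒∈ u∈A))
    drop-A u false _   = refl
    merge : ∀ {v} b → (if b then 0 else alpha A ρ v * h v) + (if b then 0 else d v) ≡ (if b then 0 else cost v (d v))
    merge true  = refl
    merge false = refl

  summand-iii : (Fin n → ℕ → Bool) → Fin n → ℕ → Fin n → ℕ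
  summand-iii x v i w = if w ∈ᵇ D then 0 else (if ⌊ dist G v w ℕ.≟ i ⌋ then ι (x w 0) else 0)

  Sstar-lookup : ∀ x v → v ∈ᵇ Sstar D x ≡ not (v ∈ᵇ D) ∧ x v 0
  Sstar-lookup x v = lookup∘tabulate (λ v → not (v ∈ᵇ D) ∧ x v 0) v

  Sstar⊆∁D : ∀ x → Sstar D x ⊆ ∁ D
  Sstar⊆∁D x {v} v∈S* =
    x∉p⇒x∈∁p (∈ᵇ⇒∉ (not-injective (proj₁ (∧-≡true⁻ (trans (sym (Sstar-lookup x v)) (∈⇒∈ᵇ v∈S*))))))

  ∣Sstar∣ : ∀ {k x} → Feasible G k D A d̃ x → ∣ Sstar D x ∣ ≡ k
  ∣Sstar∣ {k} {x} feasible =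
    trans (∣∣≡sumV (Sstar D x)) (trans (sum-map-cong (allFin n) pointwise) (Feasible.con-i feasible))
    where
    pointwise : ∀ v → ι (v ∈ᵇ Sstar D x) ≡ (if v ∈ᵇ D then 0 else ι (x v 0))
    pointwise v rewrite Sstar-lookup x v with v ∈ᵇ D
    ... | true  = refl
    ... | false = refl

  module _ {k x} (feasible : Feasible G k D A d̃ x) (sufficient : Sufficient G A d̃ x) (k≥1 : 1 ≤ k) where

    private
      S* : Subset n
      S* = Sstar D x

      decode : ∀ v {j} w → 1 ≤ summand-iii x v j w → w ∈ᵇ D ≡ false × dist G v w ≡ j × x w 0 ≡ true
      decode v {j} w hit with w ∈ᵇ D | dist G v w ℕ.≟ j | x w 0
      ... | false | yes dist≡j | true = refl , dist≡j , refl

    -- Constraint (iii) supplies a chosen vertex at distance j; for j = d̃ v, sufficiency bounds by ecc v.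
    distSet-Sstar-≤ : ∀ {v} → v ∉ A → ∀ {j} → j ≤ d̃ v → x v j ≡ true → distSet G v S* ≤ j
    distSet-Sstar-≤ {v} v∉A {j} j≤d̃ xvj with m≤n⇒m<n∨m≡n j≤d̃
    ... | inj₁ j<d̃ with w , _ , hit ← sum-map-pos (summand-iii x v j) (allFin n)
                          (subst (λ b → ι b ≤ sumV (summand-iii x v j)) xvj (Feasible.con-iii feasible v v∉A j j<d̃))
                   with w∉D , dist≡j , xw0 ← decode v w hit =
      ≤-trans (distSet-≤ (∈ᵇ⇒∈ {S = S*} (trans (Sstar-lookup x w) (cong₂ (λ a b → not a ∧ b) w∉D xw0))))
              (≤-reflexive dist≡j)
    ... | inj₂ refl with sufficient v v∉A
    ...   | inj₁ xvd̃≡false = ⊥-elim (true≢false (trans (sym xvj) xvd̃≡false))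
    ...   | inj₂ ecc≤d̃ with s₀ , s₀∈S* ← ∣∣≥1⇒nonempty S* (subst (1 ≤_) (sym (∣Sstar∣ feasible)) k≥1) = begin
      distSet G v S*  ≤⟨ distSet-≤ s₀∈S* ⟩
      dist G v s₀     ≡⟨ dist-sym v s₀ ⟩
      dist G s₀ v     ≤⟨ foldr-⊔-≥ (λ u → dist G u v) (∈-allFin s₀) ⟩
      ecc G v         ≤⟨ ecc≤d̃ ⟩
      d̃ v             ∎
      where open ≤-Reasoning

    reducedCost-Sstar : reducedCost S* ≤ objective A ρ d̃ x
    reducedCost-Sstar = sum-map-mono (allFin n) (λ v → pointwise v (v ∈ᵇ A) refl)
      where
      pointwise : ∀ v b → v ∈ᵇ A ≡ b →
        (if b then 0 else cost v (distSet G v S*)) ≤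
        (if b then 0 else sumL (L.map (λ i → ι (x v i) * cost v i) (upTo (suc (d̃ v)))))
      pointwise v true  _ = z≤n
      pointwise v false v∉A
        with j , j≤d̃ , xvj≥1 ← sumUpTo-pos (λ i → ι (x v i)) (d̃ v)
                                 (≤-reflexive (sym (Feasible.con-ii feasible v (∈ᵇ⇒∉ v∉A))))
        = begin
        cost v (distSet G v S*)  ≤⟨ cost-mono v (distSet-Sstar-≤ (∈ᵇ⇒∉ v∉A) j≤d̃ (ι≥1⇒≡true xvj≥1)) ⟩
        cost v j                 ≡⟨ *-identityˡ (cost v j) ⟨
        1 * cost v j             ≡⟨ cong (λ b → ι b * cost v j) (ι≥1⇒≡true xvj≥1) ⟨
        ι (x v j) * cost v j     ≤⟨ sumUpTo-≥ (λ i → ι (x v i) * cost v i) j≤d̃ ⟩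
        _                        ∎
        where open ≤-Reasoning

  module _ {k S′} (S′⊆∁D : S′ ⊆ ∁ D) (∣S′∣≡k : ∣ S′ ∣ ≡ k) (k≥1 : 1 ≤ k) (d̃≥1 : ∀ v → v ∉ A → 1 ≤ d̃ v) where

    truncatedDist : Fin n → ℕ
    truncatedDist v = distSet G v S′ ⊓ d̃ v

    encode : Fin n → ℕ → Bool
    encode v i = ⌊ truncatedDist v ℕ.≟ i ⌋

    private
      ∉D⇒∉A : ∀ {v} → v ∉ D → v ∉ A
      ∉D⇒∉A v∉D v∈A = v∉D (A⊆D v∈A)

      ∈S′⇒∉D : ∀ {v} → v ∈ S′ → v ∉ D
      ∈S′⇒∉D v∈S′ = x∈∁p⇒x∉p (S′⊆∁D v∈S′)

      S′-nonempty : ∃ λ s → s ∈ S′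
      S′-nonempty = ∣∣≥1⇒nonempty S′ (subst (1 ≤_) (sym ∣S′∣≡k) k≥1)

    encode-zero : ∀ {v} → v ∉ A → encode v 0 ≡ v ∈ᵇ S′
    encode-zero {v} v∉A with v ∈ᵇ S′ in v∈ᵇS′
    ... | true rewrite distSet-≡0 {v} {S′} (∈ᵇ⇒∈ v∈ᵇS′) = refl
    ... | false with truncatedDist v | ⊓-glb (distSet-≥1 {v} {S′} (∈ᵇ⇒∉ v∈ᵇS′)) (d̃≥1 v v∉A)
    ...   | suc _ | _ = refl

    encode-feasible : Feasible G k D A d̃ encode
    encode-feasible = record
      { fixed0  = λ v v∈D v∉A → trans (encode-zero v∉A) (∉⇒∈ᵇ (λ v∈S′ → ∈S′⇒∉D v∈S′ v∈D))
      ; con-i   = trans (sum-map-cong (allFin n) (λ v → chosen v (v ∈ᵇ D) refl))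
                        (trans (sym (∣∣≡sumV S′)) ∣S′∣≡k)
      ; con-ii  = λ v _ → trans (sum-map-cong (upTo (suc (d̃ v))) (λ i → sym (*-identityʳ (ι (encode v i)))))
                                (sumUpTo-indicator (λ _ → 1) {truncatedDist v} (m⊓n≤n _ (d̃ v)))
      ; con-iii = covered
      }
      where
      chosen : ∀ v b → v ∈ᵇ D ≡ b → (if b then 0 else ι (encode v 0)) ≡ ι (v ∈ᵇ S′)
      chosen v true  v∈D = cong ι (sym (∉⇒∈ᵇ (λ v∈S′ → ∈S′⇒∉D v∈S′ (∈ᵇ⇒∈ v∈D))))
      chosen v false v∉D = cong ι (encode-zero (∉D⇒∉A (∈ᵇ⇒∉ v∉D)))
      covered : ∀ v → v ∉ A → ∀ i → i < d̃ v → ι (encode v i) ≤ sumV (summand-iii encode v i)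
      covered v _ i i<d̃ with truncatedDist v ℕ.≟ i
      ... | no  _ = z≤n
      ... | yes refl with s , s∈S′ , ≡dist ← distSet-attained {v} (proj₂ S′-nonempty) =
        ≤-trans hit (sum-map-≥ (summand-iii encode v (truncatedDist v)) (∈-allFin s))
        where
        untruncated : truncatedDist v ≡ distSet G v S′
        untruncated with ⊓-sel (distSet G v S′) (d̃ v)
        ... | inj₁ ≡distSet = ≡distSet
        ... | inj₂ ≡d̃      = ⊥-elim (<-irrefl ≡d̃ i<d̃)
        hit : 1 ≤ summand-iii encode v (truncatedDist v) s
        hit with s ∈ᵇ D | ∉⇒∈ᵇ {S = D} (∈S′⇒∉D s∈S′) | dist G v s ℕ.≟ truncatedDist v
        ... | _ | refl | no dist≢ = ⊥-elim (dist≢ (trans (sym ≡dist) (sym untruncated)))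
        ... | _ | refl | yes _    =
          subst (λ b → 1 ≤ ι b) (sym (trans (encode-zero (∉D⇒∉A (∈S′⇒∉D s∈S′))) (∈⇒∈ᵇ s∈S′))) ≤-refl

    objective-encode : objective A ρ d̃ encode ≤ reducedCost S′
    objective-encode = sum-map-mono (allFin n) (λ v → pointwise v (v ∈ᵇ A))
      where
      pointwise : ∀ v b →
        (if b then 0 else sumL (L.map (λ i → ι (encode v i) * cost v i) (upTo (suc (d̃ v))))) ≤
        (if b then 0 else cost v (distSet G v S′))
      pointwise v true  = z≤n
      pointwise v false = begin
        sumL (L.map (λ i → ι (encode v i) * cost v i) (upTo (suc (d̃ v))))
          ≡⟨ sumUpTo-indicator (cost v) {truncatedDist v} (m⊓n≤n _ (d̃ v)) ⟩
        cost v (truncatedDist v)   ≤⟨ cost-mono v (m⊓n≤m _ (d̃ v)) ⟩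
        cost v (distSet G v S′)    ∎
        where open ≤-Reasoning

theorem1 : ∀ {n} (G : Graph n) → Connected G →
    (k : ℕ) → 1 ≤ k →
    (D : Subset n) → k ≤ ∣ ∁ D ∣ →
    (∀ v → v ∈ D → Σ (Fin n) λ u → (u ∉ D) × Dominates G u v) →
    (A : Subset n) → A ⊆ D →
    (ρ : Fin n → Fin n) →
    (∀ v → v ∈ A → ρ v ∉ A) →
    (∀ v → v ∈ A →
      IsCutVertex G (ρ v) ×
      (∀ w → Reach G (λ x → x ≢ ρ v) v w →
        (w ∈ D) × Dominates G (ρ v) w)) →
    (d̃ : Fin n → ℕ) → (∀ v → v ∉ A → 2 ≤ d̃ v) →
    (x : Fin n → ℕ → Bool) →
    Optimal G k D A ρ d̃ x →
    Sufficient G A d̃ x →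
    (∣ Sstar D x ∣ ≡ k) ×
    (∀ S → ∣ S ∣ ≡ k → farness G (Sstar D x) ≤ farness G S)
theorem1 {n} G conn k k≥1 D k≤∣∁D∣ dominated A A⊆D ρ ρ∉A pendant d̃ d̃≥2 x (feasible , optimal) sufficient =
  ∣Sstar∣ feasible , farness-Sstar-≤
  where
  open ReducedILP G conn D A A⊆D ρ ρ∉A (λ v v∈A → proj₂ (pendant v v∈A)) d̃
  open Distance G conn using (farness-avoiding)

  d̃≥1 : ∀ v → v ∉ A → 1 ≤ d̃ v
  d̃≥1 v v∉A = ≤-trans (n≤1+n 1) (d̃≥2 v v∉A)

  nonempty : ∀ {S} → ∣ S ∣ ≡ k → ∃ λ s → s ∈ S
  nonempty {S} ∣S∣≡k = ∣∣≥1⇒nonempty S (subst (1 ≤_) (sym ∣S∣≡k) k≥1)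

  farness-Sstar-≤ : ∀ S → ∣ S ∣ ≡ k → farness G (Sstar D x) ≤ farness G S
  farness-Sstar-≤ S ∣S∣≡k
    with S′ , S′⊆∁D , ∣S′∣≡∣S∣ , S′≤S ← farness-avoiding D dominated S (subst (_≤ ∣ ∁ D ∣) (sym ∣S∣≡k) k≤∣∁D∣) = begin
    farness G (Sstar D x)        ≡⟨ farness≡reducedCost (Sstar⊆∁D x) (proj₂ (nonempty (∣Sstar∣ feasible))) ⟩
    reducedCost (Sstar D x)      ≤⟨ reducedCost-Sstar feasible sufficient k≥1 ⟩
    objective A ρ d̃ x            ≤⟨ optimal y (encode-feasible S′⊆∁D ∣S′∣≡k k≥1 d̃≥1) ⟩
    objective A ρ d̃ y            ≤⟨ objective-encode S′⊆∁D ∣S′∣≡k k≥1 d̃≥1 ⟩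
    reducedCost S′               ≡⟨ farness≡reducedCost S′⊆∁D (proj₂ (nonempty ∣S′∣≡k)) ⟨
    farness G S′                 ≤⟨ S′≤S ⟩
    farness G S                  ∎
    where
    open ≤-Reasoning
    ∣S′∣≡k : ∣ S′ ∣ ≡ k
    ∣S′∣≡k = trans ∣S′∣≡∣S∣ ∣S∣≡k
    y : Fin n → ℕ → Bool
    y = encode S′⊆∁D ∣S′∣≡k k≥1 d̃≥1
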